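{- Let $k\ge1$, let $(\boldsymbol{A},\boldsymbol{B},\boldsymbol{C},\boldsymbol{D})$ be an instance of $\mathsf{HPC}_k$ over universes of size $n$, and let $G(V,E)$ be the undirected graph constructed from it as in the context. Then for every $i\in[n]$, the pointer $z_k$ equals $x_i$ (when $k$ is even) or $y_i$ (when $k$ is odd) if and only if $v^k_i$ belongs to the lexicographically-first maximal independent set of $G$.
   Context: $\mathsf{HPC}_k$ instance: disjoint universes $\mathcal{X}=\{x_1,\dots,x_n\}$, $\mathcal{Y}=\{y_1,\dots,y_n\}$; for each $x\in\mathcal{X}$ sets $A_x,B_x\subseteq\mathcal{Y}$ with $A_x\cap B_x=\{t_x\}$; for each $y\in\mathcal{Y}$ sets $C_y,D_y\subseteq\mathcal{X}$ with $C_y\cap D_y=\{t_y\}$; pointers $z_0=x_1$, $z_1=t_{z_0}$, $z_2=t_{z_1}$, etc. Construction of $G$: vertices are layers $V_0,\dots,V_k$ with $V_j=\{v^j_1,\dots,v^j_n\}$ plus one extra vertex $s$ with no incident edges. Lexicographic order on the layer vertices: all of $V_0$, then $V_1$, ..., then $V_k$; within $V_j$ the order is $v^j_1,\dots,v^j_n$. Edges: $v^0_1$ is adjacent to every other vertex of $V_0$; for every even $0\le j<k$ and $i,i'\in[n]$, $v^j_i$ is joined to $v^{j+1}_{i'}$ if $y_{i'}\notin A_{x_i}$ and (by another edge) if $y_{i'}\notin B_{x_i}$; for every odd $0<j<k$ and $i,i'\in[n]$, $v^j_i$ is joined to $v^{j+1}_{i'}$ if $x_{i'}\notin C_{y_i}$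 and (by another edge) if $x_{i'}\notin D_{y_i}$. The lexicographically-first maximal independent set is produced by the greedy algorithm scanning vertices in this order and adding each vertex none of whose neighbors was already added. -}

module Defs where

open import Data.Nat using (ℕ; zero; suc; _≡ᵇ_)
open import Data.Bool using (Bool; true; false; not; _∨_; _∧_; if_then_else_)
open import Data.Fin using (Fin; toℕ) renaming (zero to fzero)
open import Data.Fin.Subset using (Subset; _∩_; ⁅_⁆)
open import Data.Vec using (lookup)
open import Data.List using (List; []; _∷_; map; concatMap; _++_; allFin)
open import Relation.Binary.PropositionalEquality using (_≡_)
open import Data.Bool.ListAction using (any)

-- An instance of HPC_k over universes X = {x_1..x_n}, Y = {y_1..y_n} of size n.
-- x_i and y_i are both represented by the index i : Fin n (the two universes
-- are kept apart by the type of the family they are used with).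
record HPC (n : ℕ) : Set where
  field
    A B : Fin n → Subset n      -- A_x, B_x ⊆ Y  for x ∈ X
    C D : Fin n → Subset n      -- C_y, D_y ⊆ X  for y ∈ Y
    tX  : Fin n → Fin n         -- t_x ∈ Y
    tY  : Fin n → Fin n         -- t_y ∈ X
    AB-meet : ∀ x → A x ∩ B x ≡ ⁅ tX x ⁆
    CD-meet : ∀ y → C y ∩ D y ≡ ⁅ tY y ⁆

open HPC public

isEven : ℕ → Bool
isEven zero = true
isEven (suc j) = not (isEven j)

-- Pointers z_j, with n = suc m so that x_1 exists (index fzero).
-- z_j is the index of an element of X when j is even, of Y when j is odd.
-- z_0 = x_1, z_{j+1} = t_{z_j}.
pointer : ∀ {m} → HPC (suc m) → ℕ → Fin (suc m)
pointer I zero = fzero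
pointer I (suc j) = if isEven j then tX I (pointer I j) else tY I (pointer I j)

data Vertex (k n : ℕ) : Set where
  s : Vertex k n
  v : Fin (suc k) → Fin n → Vertex k n

-- Directed version of the layer edges: v^j_i — v^{j+1}_{i'} (from the lower layer).
-- Multiple (parallel) edges are irrelevant for independence and are merged.
layerEdge : ∀ {n} → HPC n → ℕ → Fin n → ℕ → Fin n → Bool
layerEdge I j i j' i' =
  (j' ≡ᵇ suc j) ∧
  (if isEven j
     then not (lookup (A I i) i') ∨ not (lookup (B I i) i')
     else not (lookup (C I i) i') ∨ not (lookup (D I i) i'))

isZero : ∀ {n} → Fin n → Bool
isZero fzero = true
isZero (Fin.suc _) = false

finEq : ∀ {n} → Fin n → Fin n → Bool
finEq a b = toℕ a ≡ᵇ toℕ b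

starEdge : ∀ {k n} → Fin (suc k) → Fin n → Fin (suc k) → Fin n → Bool
starEdge j i j' i' =
  isZero j ∧ isZero j' ∧ not (finEq i i') ∧ (isZero i ∨ isZero i')

adj : ∀ {k n} → HPC n → Vertex k n → Vertex k n → Bool
adj I s _ = false
adj I (v _ _) s = false
adj I (v j i) (v j' i') =
  starEdge j i j' i'
  ∨ layerEdge I (toℕ j) i (toℕ j') i'
  ∨ layerEdge I (toℕ j') i' (toℕ j) i

-- Scan order: V_0 (v^0_1..v^0_n), V_1, ..., V_k, then s (s is isolated, so
-- its position does not matter).
order : (k n : ℕ) → List (Vertex k n)
order k n = concatMap (λ j → map (v j) (allFin n)) (allFin (suc k)) ++ (s ∷ [])

greedy : {V : Set} → (V → V → Bool) → List V → List V → List V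
greedy E acc [] = acc
greedy E acc (u ∷ us) =
  if any (E u) acc then greedy E acc us else greedy E (u ∷ acc) us

LFMIS : ∀ {k n} → HPC n → List (Vertex k n)
LFMIS {k} {n} I = greedy (adj I) [] (order k n)

module Submission where

-- The greedy scan of G selects, besides the isolated vertex s, exactly the
-- "pointer vertices" v^j_{z_j}, one per layer.  The scan starts with v^0_1 = v^0_{z_0}, which kills the
-- rest of V_0 through the star edges.  Before layer V_{c+1} is scanned, the
-- chosen set consists of pointer vertices of layers ≤ c and contains
-- v^c_{z_c}.  Because A_x ∩ B_x = {t_x} (resp. C_y ∩ D_y = {t_y}), the vertex
-- v^c_{z_c} is adjacent to every v^{c+1}_x except x = z_{c+1}, while pointer
-- vertices of lower layers have no edge into V_{c+1} at all; so the scan of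
-- V_{c+1} adds exactly v^{c+1}_{z_{c+1}} and the invariant moves up a layer.

open import Defs
open import Data.Nat using (ℕ; suc; _≤_)
open import Data.Fin using (Fin; fromℕ)
open import Data.List.Membership.Propositional using (_∈_)
open import Relation.Binary.PropositionalEquality using (_≡_)
open import Function.Bundles using (_⇔_)

open import Data.Nat using (zero; _+_; _≡ᵇ_; z≤n)
open import Data.Nat.Properties using (≡ᵇ⇒≡; ≡⇒≡ᵇ; +-suc; +-identityʳ; ≤-reflexive; m≤n⇒m≤1+n)
import Data.Nat.Properties as ℕ
open import Data.Fin using (toℕ) renaming (zero to fzero; suc to fsuc)
open import Data.Fin.Properties using (toℕ-injective; toℕ-fromℕ) renaming (_≟_ to _≟ᶠ_)
open import Data.Fin.Subset using (Subset; _∩_; ⁅_⁆)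
open import Data.Fin.Subset.Properties using (x∈⁅x⁆; x∈⁅y⁆⇒x≡y)
open import Data.Vec using (lookup)
open import Data.Vec.Properties using (lookup-zipWith; []=⇒lookup; lookup⇒[]=)
open import Data.Bool using (Bool; true; false; not; _∨_; _∧_)
open import Data.Bool.Properties using (¬-not; T-≡; ∨-zeroʳ)
open import Data.Bool.ListAction using (any)
open import Data.List using (List; []; _∷_; map; concatMap; _++_; allFin; tabulate)
open import Data.List.Relation.Unary.Any using (here; there)
open import Data.List.Relation.Unary.All as All using (All; []; _∷_)
open import Data.List.Relation.Unary.All.Properties using (map⁺; tabulate⁺)
open import Data.List.Membership.Propositional.Properties using (∈-allFin)
open import Data.Product using (_×_; _,_; proj₁; proj₂; ∃-syntax)
open import Relation.Nullary using (¬_; yes; no; contradiction)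
open import Relation.Binary.PropositionalEquality using (refl; sym; trans; cong; subst; subst₂; module ≡-Reasoning)
open import Function.Bundles using (mk⇔; Equivalence)
open import Function.Base using (_∘_)

≡ᵇ-refl : ∀ a → (a ≡ᵇ a) ≡ true
≡ᵇ-refl a = Equivalence.to T-≡ (≡⇒≡ᵇ a a refl)

≡ᵇ-≢ : ∀ {a b} → ¬ a ≡ b → (a ≡ᵇ b) ≡ false
≡ᵇ-≢ {a} {b} a≢b = ¬-not (λ eq → a≢b (≡ᵇ⇒≡ a b (Equivalence.from T-≡ eq)))

not-∧ : ∀ a b → not (a ∧ b) ≡ not a ∨ not b
not-∧ true  b = refl
not-∧ false b = refl

⁅⁆-self : ∀ {n} (t : Fin n) → lookup ⁅ t ⁆ t ≡ true
⁅⁆-self t = []=⇒lookup (x∈⁅x⁆ t)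

⁅⁆-other : ∀ {n} {x t : Fin n} → ¬ x ≡ t → lookup ⁅ t ⁆ x ≡ false
⁅⁆-other {x = x} {t} x≢t = ¬-not (λ eq → x≢t (x∈⁅y⁆⇒x≡y t (lookup⇒[]= x ⁅ t ⁆ eq)))

-- When the meet is a singleton ⁅ t ⁆, x is joined to all of the next layer
-- except t: this is the mechanism that makes the pointer chain survive.
missesMeet : ∀ {n} (S T : Subset n) {t : Fin n} → S ∩ T ≡ ⁅ t ⁆ → ∀ x →
             (not (lookup S x) ∨ not (lookup T x)) ≡ not (lookup ⁅ t ⁆ x)
missesMeet S T {t} meet x = begin
  not (lookup S x) ∨ not (lookup T x)  ≡⟨ sym (not-∧ (lookup S x) (lookup T x)) ⟩
  not (lookup S x ∧ lookup T x)        ≡⟨ cong not (sym (lookup-zipWith _∧_ x S T)) ⟩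
  not (lookup (S ∩ T) x)               ≡⟨ cong (λ U → not (lookup U x)) meet ⟩
  not (lookup ⁅ t ⁆ x)                 ∎
  where open ≡-Reasoning

any-false : ∀ {V : Set} (f : V → Bool) (xs : List V) → All (λ w → f w ≡ false) xs → any f xs ≡ false
any-false f []       []             = refl
any-false f (w ∷ xs) (fw≡false ∷ h) rewrite fw≡false = any-false f xs h

any-true : ∀ {V : Set} (f : V → Bool) {xs : List V} {w : V} → w ∈ xs → f w ≡ true → any f xs ≡ true
any-true f {x ∷ xs} (here refl) fx≡true rewrite fx≡true = refl
any-true f {x ∷ xs} (there w∈xs) fw≡true rewrite any-true f w∈xs fw≡true = ∨-zeroʳ (f x)

module Greedy {V : Set} (E : V → V → Bool) where

  greedy-++ : ∀ acc xs ys → greedy E acc (xs ++ ys) ≡ greedy E (greedy E acc xs) ys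
  greedy-++ acc []       ys = refl
  greedy-++ acc (x ∷ xs) ys with any (E x) acc
  ... | true  = greedy-++ acc xs ys
  ... | false = greedy-++ (x ∷ acc) xs ys

  greedy-adds : ∀ acc u us → any (E u) acc ≡ false → greedy E acc (u ∷ us) ≡ greedy E (u ∷ acc) us
  greedy-adds acc u us no-nbr rewrite no-nbr = refl

  greedy-skips : ∀ acc u us → any (E u) acc ≡ true → greedy E acc (u ∷ us) ≡ greedy E acc us
  greedy-skips acc u us nbr rewrite nbr = refl

  greedy-skips-all : ∀ {acc} us → All (λ u → any (E u) acc ≡ true) us → greedy E acc us ≡ acc
  greedy-skips-all []       []           = refl
  greedy-skips-all {acc} (u ∷ us) (nbr ∷ nbrs) =
    trans (greedy-skips acc u us nbr) (greedy-skips-all us nbrs)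

  greedy-keeps : ∀ {acc w} us → w ∈ acc → w ∈ greedy E acc us
  greedy-keeps {acc} []       w∈acc = w∈acc
  greedy-keeps {acc} (u ∷ us) w∈acc with any (E u) acc
  ... | true  = greedy-keeps us w∈acc
  ... | false = greedy-keeps us (there w∈acc)

module Scan (k m : ℕ) (I : HPC (suc m)) where

  open Greedy (adj {k} I)

  n : ℕ
  n = suc m

  V : Set
  V = Vertex k n

  z : ℕ → Fin n
  z = pointer I

  layer : Fin (suc k) → List V
  layer j = map (v j) (allFin n)

  data OnPath (d : ℕ) : V → Set where
    on-path : ∀ {j} → toℕ j ≤ d → OnPath d (v j (z (toℕ j)))

  on-path-pointer : ∀ {d j i} → OnPath d (v j i) → i ≡ z (toℕ j)
  on-path-pointer (on-path _) = refl

  Reaches : ℕ → List V → Set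
  Reaches c acc = ∃[ j ] toℕ j ≡ c × v j (z c) ∈ acc

  Invariant : ℕ → List V → Set
  Invariant c acc = All (OnPath c) acc × Reaches c acc

  layerEdge-far : ∀ {t t'} (i i' : Fin n) → ¬ t' ≡ suc t → layerEdge I t i t' i' ≡ false
  layerEdge-far {t} {t'} i i' far rewrite ≡ᵇ-≢ far = refl

  pointerEdge : ∀ c x → layerEdge I c (z c) (suc c) x ≡ not (lookup ⁅ z (suc c) ⁆ x)
  pointerEdge c x rewrite ≡ᵇ-refl c with isEven c
  ... | true  = missesMeet (A I (z c)) (B I (z c)) (AB-meet I (z c)) x
  ... | false = missesMeet (C I (z c)) (D I (z c)) (CD-meet I (z c)) x

  pointerEdge-self : ∀ {t} c → t ≡ c → layerEdge I t (z t) (suc c) (z (suc c)) ≡ false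
  pointerEdge-self c refl rewrite pointerEdge c (z (suc c)) | ⁅⁆-self (z (suc c)) = refl

  pointerEdge-other : ∀ c {x} → ¬ x ≡ z (suc c) → layerEdge I c (z c) (suc c) x ≡ true
  pointerEdge-other c {x} x≢z rewrite pointerEdge c x | ⁅⁆-other x≢z = refl

  ≤⇒≢suc : ∀ {a b} → a ≤ b → ¬ a ≡ suc b
  ≤⇒≢suc a≤b refl = ℕ.<-irrefl refl a≤b

  -- The next pointer vertex has no neighbour among the pointer vertices of
  -- layers up to its own: no star edge (its layer is not 0), no edge to layer
  -- c+2, and the only candidate edge from layer c is missing.
  next-pointer-free : ∀ {c} (j : Fin (suc k)) → toℕ j ≡ suc c →
                      ∀ {w} → OnPath (suc c) w → adj I (v j (z (suc c))) w ≡ false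
  next-pointer-free {c} (fsuc _) refl (on-path {j'} j'≤) with toℕ j' ℕ.≟ c
  ... | yes j'≡c rewrite layerEdge-far {suc c} (z (suc c)) (z (toℕ j')) (≤⇒≢suc j'≤)
                       | pointerEdge-self c j'≡c = refl
  ... | no  j'≢c rewrite layerEdge-far {suc c} (z (suc c)) (z (toℕ j')) (≤⇒≢suc j'≤)
                       | layerEdge-far {toℕ j'} (z (toℕ j')) (z (suc c)) (j'≢c ∘ ℕ.suc-injective ∘ sym) = refl

  pointer-dominates : ∀ {c} (j j' : Fin (suc k)) → toℕ j ≡ suc c → toℕ j' ≡ c →
                      ∀ {x} → ¬ x ≡ z (suc c) → adj I (v j x) (v j' (z c)) ≡ true
  pointer-dominates {c} j j' hj hj' {x} x≢z rewrite hj | hj' | pointerEdge-other c x≢z =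
    trans (cong (starEdge j x j' (z c) ∨_) (∨-zeroʳ _)) (∨-zeroʳ _)

  ScanOK : ℕ → Fin (suc k) → List (Fin n) → List V → Set
  ScanOK c j xs res = All (OnPath (suc c)) res × (z (suc c) ∈ xs → v j (z (suc c)) ∈ res)

  scanLayer : ∀ {c} (j : Fin (suc k)) → toℕ j ≡ suc c → ∀ xs acc →
              All (OnPath (suc c)) acc → Reaches c acc →
              ScanOK c j xs (greedy (adj I) acc (map (v j) xs))
  scanLayer j hj []       acc onPath reaches = onPath , λ ()
  scanLayer {c} j hj (x ∷ xs) acc onPath reaches@(j' , hj' , prev) with x ≟ᶠ z (suc c)
  ... | yes refl =
    subst (ScanOK c j (x ∷ xs)) (sym adds)
          (onPath' , λ _ → greedy-keeps {v j x ∷ acc} (map (v j) xs) (here refl))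
    where
    adds : greedy (adj I) acc (map (v j) (x ∷ xs)) ≡ greedy (adj I) (v j x ∷ acc) (map (v j) xs)
    adds = greedy-adds acc (v j x) (map (v j) xs) (any-false _ acc (All.map (next-pointer-free j hj) onPath))
    new : OnPath (suc c) (v j (z (suc c)))
    new = subst (λ t → OnPath (suc c) (v j (z t))) hj (on-path (≤-reflexive hj))
    onPath' : All (OnPath (suc c)) (greedy (adj I) (v j x ∷ acc) (map (v j) xs))
    onPath' = proj₁ (scanLayer j hj xs (v j x ∷ acc) (new ∷ onPath) (j' , hj' , there prev))
  ... | no x≢z =
    subst (ScanOK c j (x ∷ xs)) (sym skips)
          (onPath' , λ { (here eq) → contradiction (sym eq) x≢z ; (there z∈xs) → chosen z∈xs })
    where
    skips : greedy (adj I) acc (map (v j) (x ∷ xs)) ≡ greedy (adj I) acc (map (v j) xs)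
    skips = greedy-skips acc (v j x) (map (v j) xs) (any-true _ prev (pointer-dominates j j' hj hj' x≢z))
    rest : ScanOK c j xs (greedy (adj I) acc (map (v j) xs))
    rest = scanLayer j hj xs acc onPath reaches
    onPath' : All (OnPath (suc c)) (greedy (adj I) acc (map (v j) xs))
    onPath' = proj₁ rest
    chosen : z (suc c) ∈ xs → v j (z (suc c)) ∈ greedy (adj I) acc (map (v j) xs)
    chosen = proj₂ rest

  stepLayer : ∀ {c acc} (j : Fin (suc k)) → toℕ j ≡ suc c →
              Invariant c acc → Invariant (suc c) (greedy (adj I) acc (layer j))
  stepLayer {c} {acc} j hj (onPath , reaches)
    with scanLayer j hj (allFin n) acc (All.map weaken onPath) reaches
    where weaken : ∀ {w} → OnPath c w → OnPath (suc c) w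
          weaken (on-path le) = on-path (m≤n⇒m≤1+n le)
  ... | onPath' , chosen = onPath' , (j , hj , chosen (∈-allFin _))

  scanLayers : ∀ r (g : Fin r → Fin (suc k)) c → (∀ i → toℕ (g i) ≡ suc (c + toℕ i)) →
               ∀ {acc} → Invariant c acc →
               Invariant (c + r) (greedy (adj I) acc (concatMap layer (tabulate g)))
  scanLayers zero g c hg {acc} inv = subst (λ t → Invariant t acc) (sym (+-identityʳ c)) inv
  scanLayers (suc r) g c hg {acc} inv =
    subst₂ Invariant (sym (+-suc c r)) (sym split)
      (scanLayers r g' (suc c) (λ i → trans (hg (fsuc i)) (cong suc (+-suc c (toℕ i))))
        (stepLayer (g fzero) (trans (hg fzero) (cong suc (+-identityʳ c))) inv))
    where
    g' : Fin r → Fin (suc k)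
    g' i = g (fsuc i)
    split : greedy (adj I) acc (concatMap layer (tabulate g))
          ≡ greedy (adj I) (greedy (adj I) acc (layer (g fzero))) (concatMap layer (tabulate g'))
    split = greedy-++ acc (layer (g fzero)) (concatMap layer (tabulate g'))

  -- After layer 0 only v^0_1 is chosen: it dominates V_0 through the star.
  start : List V
  start = v fzero fzero ∷ []

  scanLayer0 : greedy (adj I) [] (layer fzero) ≡ start
  scanLayer0 = greedy-skips-all (map (v fzero) (tabulate fsuc)) (map⁺ (tabulate⁺ (λ _ → refl)))

  invariant0 : Invariant 0 start
  invariant0 = (on-path z≤n ∷ []) , (fzero , refl , here refl)

  upperLayers : List V
  upperLayers = concatMap layer (tabulate fsuc)

  LFMIS-layers : LFMIS {k} {n} I ≡ s ∷ greedy (adj I) start upperLayers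
  LFMIS-layers = begin
    greedy (adj I) [] (concatMap layer (allFin (suc k)) ++ s ∷ [])
      ≡⟨ greedy-++ [] (concatMap layer (allFin (suc k))) (s ∷ []) ⟩
    greedy (adj I) (greedy (adj I) [] (layer fzero ++ upperLayers)) (s ∷ [])
      ≡⟨ cong (λ acc → greedy (adj I) acc (s ∷ [])) (greedy-++ [] (layer fzero) upperLayers) ⟩
    greedy (adj I) (greedy (adj I) (greedy (adj I) [] (layer fzero)) upperLayers) (s ∷ [])
      ≡⟨ cong (λ acc → greedy (adj I) (greedy (adj I) acc upperLayers) (s ∷ [])) scanLayer0 ⟩
    greedy (adj I) (greedy (adj I) start upperLayers) (s ∷ [])
      ≡⟨ greedy-adds (greedy (adj I) start upperLayers) s [] s-isolated ⟩
    s ∷ greedy (adj I) start upperLayers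
      ∎
    where
    open ≡-Reasoning
    chosen : List V
    chosen = greedy (adj I) start upperLayers
    s-isolated : any (adj I s) chosen ≡ false
    s-isolated = any-false (adj I s) chosen (All.universal (λ _ → refl) chosen)

  invariantTop : Invariant k (greedy (adj I) start upperLayers)
  invariantTop = scanLayers k fsuc 0 (λ _ → refl) invariant0

lemma6p8 : (k m : ℕ) → 1 ≤ k → (I : HPC (suc m)) → (i : Fin (suc m))
    → (pointer I k ≡ i) ⇔ (v {k} {suc m} (fromℕ k) i ∈ LFMIS I)
lemma6p8 k m _ I i rewrite Scan.LFMIS-layers k m I = mk⇔ chosen-if-pointer pointer-if-chosen
  where
  open Scan k m I

  chosen-if-pointer : pointer I k ≡ i → v (fromℕ k) i ∈ s ∷ greedy (adj I) start upperLayers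
  chosen-if-pointer refl with invariantTop
  ... | _ , (j , hj , z∈) rewrite toℕ-injective {i = j} {j = fromℕ k} (trans hj (sym (toℕ-fromℕ k)))
    = there z∈

  pointer-if-chosen : v (fromℕ k) i ∈ s ∷ greedy (adj I) start upperLayers → pointer I k ≡ i
  pointer-if-chosen (there i∈) with invariantTop
  ... | onPath , _ =
    sym (trans (on-path-pointer (All.lookup onPath i∈)) (cong (pointer I) (toℕ-fromℕ k)))
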